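{- Fix $n\ge1$. There exists an increasing function $M:\mathbb{Z}^n\to\mathbb{Z}$ such that: (i) $M(\mathbf{x}+n^2\mathbf{e}_j)=M(\mathbf{x})+n$ for all $\mathbf{x}\in\mathbb{Z}^n$ and $1\le j\le n$; (ii) if $\mathbf{x}\in\mathbb{Z}^n$ satisfies $\max_jx_j-\min_jx_j\le n-1$, then $M(\mathbf{x})=\min_jx_j$.
   Context: $\mathbf{e}_j$ is the $j$th standard basis vector of $\mathbb{Z}^n$; increasing means $\mathbf{x}\le\mathbf{y}$ coordinatewise implies $M(\mathbf{x})\le M(\mathbf{y})$. -}

module Defs where

open import Data.Nat using (ℕ; suc)
open import Data.Fin using (Fin; zero; suc; _≟_)
open import Data.Integer using (ℤ; _+_; _-_; _⊔_; _⊓_; _≤_; +_)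
open import Relation.Nullary using (does)
open import Data.Bool using (if_then_else_)

Point : ℕ → Set
Point n = Fin n → ℤ

_≤ᵖ_ : ∀ {n} → Point n → Point n → Set
x ≤ᵖ y = ∀ i → x i ≤ y i

Increasing : ∀ {n} → (Point n → ℤ) → Set
Increasing {n} M = ∀ (x y : Point n) → x ≤ᵖ y → M x ≤ M y

addAt : ∀ {n} → Point n → Fin n → ℤ → Point n
addAt x j c i = if does (i Data.Fin.≟ j) then x i + c else x i

maxCoord : ∀ {m} → Point (suc m) → ℤ
maxCoord {ℕ.zero} x = x zero
maxCoord {suc m} x = x zero ⊔ maxCoord (λ i → x (suc i))

minCoord : ∀ {m} → Point (suc m) → ℤ
minCoord {ℕ.zero} x = x zero
minCoord {suc m} x = x zero ⊓ minCoord (λ i → x (suc i))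

module Submission where

-- Idea.  For x ∈ ℤⁿ consider the counting function
--     φₓ (t) = Σᵢ ⌊ (xᵢ - t) / N ⌋ ,
-- which is non-increasing in t and non-decreasing in x, and put M x = the
-- threshold of φₓ, i.e. the unique t with φₓ (t) ≥ 0 > φₓ (t + 1).  Then
--   * monotonicity of φ in x pushes thresholds up, so M is increasing;
--   * φ_{x + N²eⱼ} (s) = φₓ (s) + N = φₓ (s - N) (one floor gains N, resp.
--     all N floors gain 1), so the threshold moves by exactly N;
--   * if max x - min x < N then φₓ (min x) ≥ 0 > φₓ (min x + 1).

open import Defs
open import Data.Nat using (ℕ; suc; _*_)
open import Data.Fin using (Fin)
open import Data.Integer using (ℤ; +_; _+_; _-_; _≤_)
open import Data.Product using (Σ; _×_)
open import Relation.Binary.PropositionalEquality using (_≡_)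

import Data.Nat as ℕ
import Data.Nat.Properties as ℕ
open import Data.Fin using (zero; suc; _≟_)
open import Data.Fin.Properties using (suc-injective)
open import Data.Integer using (_<_; -_; 0ℤ; 1ℤ; -1ℤ; ∣_∣; +<+; -<+)
-- Integer multiplication is written _·_, since _*_ is the ℕ product of the statement.
open import Data.Integer using () renaming (_*_ to _·_)
open import Data.Integer.Properties hiding (_≟_)
open import Data.Integer.DivMod using (_/ℕ_; _%ℕ_; a≡a%ℕn+[a/ℕn]*n; n%ℕd<d)
open import Data.Integer.Tactic.RingSolver using (solve-∀)
open import Data.Product using (_,_; proj₁; proj₂; ∃)
open import Data.Sum using (inj₁; inj₂)
open import Relation.Nullary using (¬_; Dec; yes; no)
open import Relation.Nullary.Negation using (contradiction)
open import Relation.Binary.PropositionalEquality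
  using (refl; sym; trans; cong; cong₂; subst; subst₂; _≢_; module ≡-Reasoning)

∑ : ∀ {k} → (Fin k → ℤ) → ℤ
∑ {ℕ.zero} f = 0ℤ
∑ {suc k}  f = f zero + ∑ (λ i → f (suc i))

∑-mono : ∀ {k} {f g : Fin k → ℤ} → (∀ i → f i ≤ g i) → ∑ f ≤ ∑ g
∑-mono {ℕ.zero} f≤g = ≤-refl
∑-mono {suc k}  f≤g = +-mono-≤ (f≤g zero) (∑-mono (λ i → f≤g (suc i)))

∑-cong : ∀ {k} {f g : Fin k → ℤ} → (∀ i → f i ≡ g i) → ∑ f ≡ ∑ g
∑-cong {ℕ.zero} f≡g = refl
∑-cong {suc k}  f≡g = cong₂ _+_ (f≡g zero) (∑-cong (λ i → f≡g (suc i)))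

∑-nonneg : ∀ {k} {f : Fin k → ℤ} → (∀ i → 0ℤ ≤ f i) → 0ℤ ≤ ∑ f
∑-nonneg {ℕ.zero} f≥0 = ≤-refl
∑-nonneg {suc k}  f≥0 = +-mono-≤ (f≥0 zero) (∑-nonneg (λ i → f≥0 (suc i)))

∑-negative : ∀ {k} {f : Fin k → ℤ} (j : Fin k) →
  (∀ i → f i ≤ 0ℤ) → f j < 0ℤ → ∑ f < 0ℤ
∑-negative {suc k} zero f≤0 fj<0 = +-mono-<-≤ fj<0 (∑-nonpos (λ i → f≤0 (suc i)))
  where
  ∑-nonpos : ∀ {k} {f : Fin k → ℤ} → (∀ i → f i ≤ 0ℤ) → ∑ f ≤ 0ℤ
  ∑-nonpos {ℕ.zero} f≤0 = ≤-refl
  ∑-nonpos {suc k}  f≤0 = +-mono-≤ (f≤0 zero) (∑-nonpos (λ i → f≤0 (suc i)))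
∑-negative {suc k} (suc j) f≤0 fj<0 =
  +-mono-≤-< (f≤0 zero) (∑-negative j (λ i → f≤0 (suc i)) fj<0)

∑-+const : ∀ {k} (f : Fin k → ℤ) (c : ℤ) → ∑ (λ i → f i + c) ≡ ∑ f + + k · c
∑-+const {ℕ.zero} f c = sym (+-identityʳ 0ℤ)
∑-+const {suc k}  f c = begin
  f zero + c + ∑ (λ i → f (suc i) + c)      ≡⟨ cong (_+_ (f zero + c)) (∑-+const (λ i → f (suc i)) c) ⟩
  f zero + c + (∑ (λ i → f (suc i)) + + k · c) ≡⟨ regroup (f zero) c (∑ (λ i → f (suc i))) (+ k) ⟩
  f zero + ∑ (λ i → f (suc i)) + + suc k · c ∎
  where
  open ≡-Reasoning
  regroup : ∀ a c s k → a + c + (s + k · c) ≡ a + s + (1ℤ + k) · c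
  regroup = solve-∀

∑-update : ∀ {k} (f g : Fin k → ℤ) (j : Fin k) (c : ℤ) →
  g j ≡ f j + c → (∀ i → i ≢ j → g i ≡ f i) → ∑ g ≡ ∑ f + c
∑-update {suc k} f g zero c gj others = begin
  g zero + ∑ (λ i → g (suc i)) ≡⟨ cong₂ _+_ gj (∑-cong (λ i → others (suc i) (λ ()))) ⟩
  f zero + c + ∑ (λ i → f (suc i)) ≡⟨ swap (f zero) c (∑ (λ i → f (suc i))) ⟩
  f zero + ∑ (λ i → f (suc i)) + c ∎
  where
  open ≡-Reasoning
  swap : ∀ a c s → a + c + s ≡ a + s + c
  swap = solve-∀
∑-update {suc k} f g (suc j) c gj others = begin
  g zero + ∑ (λ i → g (suc i))     ≡⟨ cong₂ _+_ (others zero (λ ())) tail-update ⟩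
  f zero + (∑ (λ i → f (suc i)) + c) ≡⟨ sym (+-assoc (f zero) _ c) ⟩
  f zero + ∑ (λ i → f (suc i)) + c ∎
  where
  open ≡-Reasoning
  tail-update : ∑ (λ i → g (suc i)) ≡ ∑ (λ i → f (suc i)) + c
  tail-update = ∑-update (λ i → f (suc i)) (λ i → g (suc i)) j c gj
    (λ i i≢j → others (suc i) (λ si≡sj → i≢j (suc-injective si≡sj)))

addAt-same : ∀ {k} (x : Point k) j c → addAt x j c j ≡ x j + c
addAt-same x j c with j ≟ j
... | yes _   = refl
... | no j≢j = contradiction refl j≢j

addAt-other : ∀ {k} (x : Point k) j c i → i ≢ j → addAt x j c i ≡ x i
addAt-other x j c i i≢j with i ≟ j
... | yes i≡j = contradiction i≡j i≢j
... | no _    = refl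

minCoord≤ : ∀ {k} (x : Point (suc k)) i → minCoord x ≤ x i
minCoord≤ {ℕ.zero} x zero    = ≤-refl
minCoord≤ {suc k}  x zero    = i⊓j≤i _ _
minCoord≤ {suc k}  x (suc i) = ≤-trans (i⊓j≤j _ _) (minCoord≤ (λ i → x (suc i)) i)

≤maxCoord : ∀ {k} (x : Point (suc k)) i → x i ≤ maxCoord x
≤maxCoord {ℕ.zero} x zero    = ≤-refl
≤maxCoord {suc k}  x zero    = i≤i⊔j _ _
≤maxCoord {suc k}  x (suc i) = ≤-trans (≤maxCoord (λ i → x (suc i)) i) (i≤j⊔i _ _)

minCoord-attained : ∀ {k} (x : Point (suc k)) → ∃ λ j → x j ≡ minCoord x
minCoord-attained {ℕ.zero} x = zero , refl
minCoord-attained {suc k} x with ⊓-sel (x zero) (minCoord (λ i → x (suc i)))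
... | inj₁ head-is-min = zero , sym head-is-min
... | inj₂ tail-is-min with minCoord-attained (λ i → x (suc i))
...   | j , xj≡min = suc j , trans xj≡min (sym tail-is-min)

module Floor (d : ℕ) .{{_ : ℕ.NonZero d}} where

  D : ℤ
  D = + d

  ⌊_⌋ : ℤ → ℤ
  ⌊ y ⌋ = y /ℕ d

  ⌊⌋·D≤ : ∀ y → ⌊ y ⌋ · D ≤ y
  ⌊⌋·D≤ y = subst (⌊ y ⌋ · D ≤_) (sym (a≡a%ℕn+[a/ℕn]*n y d)) (i≤j+i _ (+ (y %ℕ d)))

  <⌊⌋·D+D : ∀ y → y < ⌊ y ⌋ · D + D
  <⌊⌋·D+D y = subst₂ _<_ (sym (a≡a%ℕn+[a/ℕn]*n y d)) (+-comm D (⌊ y ⌋ · D))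
    (+-monoˡ-< (⌊ y ⌋ · D) (+<+ (n%ℕd<d y d)))

  blocks-ordered : ∀ {p q y} → p · D ≤ y → y < q · D + D → p ≤ q
  blocks-ordered {p} {q} {y} pD≤y y<qD+D = ≮⇒≥ λ q<p →
    ≤⇒≯ (≤-trans (subst (_≤ p · D) next-block (*-monoʳ-≤-nonNeg D (i<j⇒suc[i]≤j q<p))) pD≤y) y<qD+D
    where
    next-block : (1ℤ + q) · D ≡ q · D + D
    next-block = trans (suc-* q D) (+-comm D (q · D))

  ≤⌊⌋ : ∀ {q y} → q · D ≤ y → q ≤ ⌊ y ⌋
  ≤⌊⌋ {y = y} qD≤y = blocks-ordered qD≤y (<⌊⌋·D+D y)

  ⌊⌋≤ : ∀ {q y} → y < q · D + D → ⌊ y ⌋ ≤ q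
  ⌊⌋≤ {y = y} y<qD+D = blocks-ordered (⌊⌋·D≤ y) y<qD+D

  ⌊⌋-mono : ∀ {a b} → a ≤ b → ⌊ a ⌋ ≤ ⌊ b ⌋
  ⌊⌋-mono {a} a≤b = ≤⌊⌋ (≤-trans (⌊⌋·D≤ a) a≤b)

  ⌊⌋-shift : ∀ y k → ⌊ y + k · D ⌋ ≡ ⌊ y ⌋ + k
  ⌊⌋-shift y k = ≤-antisym
    (⌊⌋≤ (subst (y + k · D <_) (distribʳ-block ⌊ y ⌋ k D) (+-monoˡ-< (k · D) (<⌊⌋·D+D y))))
    (≤⌊⌋ (subst (_≤ y + k · D) (sym (*-distribʳ-+ D ⌊ y ⌋ k)) (+-monoˡ-≤ (k · D) (⌊⌋·D≤ y))))
    where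
    distribʳ-block : ∀ q k D → q · D + D + k · D ≡ (q + k) · D + D
    distribʳ-block = solve-∀

  ⌊⌋-nonneg : ∀ {y} → 0ℤ ≤ y → 0ℤ ≤ ⌊ y ⌋
  ⌊⌋-nonneg 0≤y = ≤⌊⌋ 0≤y

  ⌊⌋-nonpos : ∀ {y} → y < D → ⌊ y ⌋ ≤ 0ℤ
  ⌊⌋-nonpos y<D = ⌊⌋≤ y<D

  ⌊⌋-negative : ∀ {y} → y < 0ℤ → ⌊ y ⌋ < 0ℤ
  ⌊⌋-negative {y} y<0 = ≤-<-trans (⌊⌋≤ {q = -1ℤ} (subst (y <_) (sym (cancel D)) y<0)) -<+
    where
    cancel : ∀ D → -1ℤ · D + D ≡ 0ℤ
    cancel = solve-∀

IsThreshold : (ℤ → ℤ) → ℤ → Set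
IsThreshold φ t = 0ℤ ≤ φ t × φ (t + 1ℤ) < 0ℤ

Antitone : (ℤ → ℤ) → Set
Antitone φ = ∀ {s t} → s ≤ t → φ t ≤ φ s

threshold-greatest : ∀ {φ} → Antitone φ → ∀ {s t} → 0ℤ ≤ φ s → IsThreshold φ t → s ≤ t
threshold-greatest φ-anti {s} {t} 0≤φs (_ , φt+1<0) = ≮⇒≥ λ t<s →
  ≤⇒≯ (≤-trans 0≤φs (φ-anti (subst (_≤ s) (+-comm 1ℤ t) (i<j⇒suc[i]≤j t<s)))) φt+1<0

threshold-unique : ∀ {φ} → Antitone φ → ∀ {s t} → IsThreshold φ s → IsThreshold φ t → s ≡ t
threshold-unique φ-anti hs ht =
  ≤-antisym (threshold-greatest φ-anti (proj₁ hs) ht) (threshold-greatest φ-anti (proj₁ ht) hs)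

last-true : (P : ℤ → Set) → (∀ t → Dec (P t)) →
  ∀ a K → P a → ¬ P (a + + K) → ∃ λ t → P t × ¬ P (t + 1ℤ)
last-true P P? a ℕ.zero    Pa ¬Pa+0 = contradiction (subst P (sym (+-identityʳ a)) Pa) ¬Pa+0
last-true P P? a (suc K) Pa ¬Pa+K+1 with P? (a + + K)
... | yes Pa+K = a + + K , Pa+K , λ P[a+K+1] → ¬Pa+K+1 (subst P (step K) P[a+K+1])
  where
  step : ∀ K → a + + K + 1ℤ ≡ a + + suc K
  step K = trans (+-assoc a (+ K) 1ℤ) (cong (λ n → a + + n) (ℕ.+-comm K 1))
... | no ¬Pa+K = last-true P P? a K Pa ¬Pa+K

threshold-exists : ∀ φ {a b} → a ≤ b → 0ℤ ≤ φ a → φ b < 0ℤ → ∃ (IsThreshold φ)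
threshold-exists φ {a} {b} a≤b 0≤φa φb<0
  with last-true (λ t → 0ℤ ≤ φ t) (λ t → 0ℤ ≤? φ t) a ∣ a - b ∣ 0≤φa ¬0≤φ[a+K]
  where
  a+K≡b : a + + ∣ a - b ∣ ≡ b
  a+K≡b = trans (cong (_+_ a) (∣-∣-≤ a≤b)) (complement a b)
    where
    complement : ∀ a b → a + (b - a) ≡ b
    complement = solve-∀
  ¬0≤φ[a+K] : ¬ (0ℤ ≤ φ (a + + ∣ a - b ∣))
  ¬0≤φ[a+K] 0≤ = ≤⇒≯ (subst (λ t → 0ℤ ≤ φ t) a+K≡b 0≤) φb<0
... | t , 0≤φt , ¬0≤φt+1 = t , 0≤φt , ≰⇒> ¬0≤φt+1

threshold-translate : ∀ {φ ψ} c → (∀ s → ψ s ≡ φ (s - c)) →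
  ∀ {t} → IsThreshold φ t → IsThreshold ψ (t + c)
threshold-translate {φ} c ψ≡φ∘translate {t} (0≤φt , φt+1<0) =
    subst (0ℤ ≤_) (sym (trans (ψ≡φ∘translate _) (cong φ (back t c)))) 0≤φt
  , subst (_< 0ℤ) (sym (trans (ψ≡φ∘translate _) (cong φ (back+1 t c)))) φt+1<0
  where
  back : ∀ t c → t + c - c ≡ t
  back = solve-∀
  back+1 : ∀ t c → t + c + 1ℤ - c ≡ t + 1ℤ
  back+1 = solve-∀

module Construction (m : ℕ) where

  open Floor (suc m)

  φ : Point (suc m) → ℤ → ℤ
  φ x t = ∑ (λ i → ⌊ x i - t ⌋)

  φ-antitone : ∀ x → Antitone (φ x)
  φ-antitone x s≤t = ∑-mono (λ i → ⌊⌋-mono (+-monoʳ-≤ (x i) (neg-mono-≤ s≤t)))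

  φ-monotone : ∀ {x y} t → x ≤ᵖ y → φ x t ≤ φ y t
  φ-monotone t x≤y = ∑-mono (λ i → ⌊⌋-mono (+-monoˡ-≤ (- t) (x≤y i)))

  φ-nonneg : ∀ x {t} → t ≤ minCoord x → 0ℤ ≤ φ x t
  φ-nonneg x t≤min = ∑-nonneg (λ i → ⌊⌋-nonneg (i≤j⇒0≤j-i (≤-trans t≤min (minCoord≤ x i))))

  φ-negative : ∀ x {t} j → (∀ i → x i - t < D) → x j - t < 0ℤ → φ x t < 0ℤ
  φ-negative x j below-D xj-t<0 = ∑-negative j (λ i → ⌊⌋-nonpos (below-D i)) (⌊⌋-negative xj-t<0)

  -- Lowering t by N raises each of the N terms by one.
  φ-lower : ∀ x t → φ x (t - D) ≡ φ x t + D
  φ-lower x t = begin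
    ∑ (λ i → ⌊ x i - (t - D) ⌋)         ≡⟨ ∑-cong (λ i → cong ⌊_⌋ (regroup (x i) t D)) ⟩
    ∑ (λ i → ⌊ x i - t + 1ℤ · D ⌋)      ≡⟨ ∑-cong (λ i → ⌊⌋-shift (x i - t) 1ℤ) ⟩
    ∑ (λ i → ⌊ x i - t ⌋ + 1ℤ)          ≡⟨ ∑-+const (λ i → ⌊ x i - t ⌋) 1ℤ ⟩
    φ x t + D · 1ℤ                      ≡⟨ cong (_+_ (φ x t)) (*-identityʳ D) ⟩
    φ x t + D                           ∎
    where
    open ≡-Reasoning
    regroup : ∀ a t D → a - (t - D) ≡ a - t + 1ℤ · D
    regroup = solve-∀

  -- Raising xⱼ by N² raises the j-th term by N.
  φ-raise : ∀ x j t → φ (addAt x j (+ (suc m * suc m))) t ≡ φ x t + D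
  φ-raise x j t = ∑-update (λ i → ⌊ x i - t ⌋) (λ i → ⌊ addAt x j N² i - t ⌋) j D
    (begin
      ⌊ addAt x j N² j - t ⌋ ≡⟨ cong (λ z → ⌊ z - t ⌋) (addAt-same x j N²) ⟩
      ⌊ x j + N² - t ⌋       ≡⟨ cong ⌊_⌋ (regroup (x j) t) ⟩
      ⌊ x j - t + D · D ⌋    ≡⟨ ⌊⌋-shift (x j - t) D ⟩
      ⌊ x j - t ⌋ + D        ∎)
    (λ i i≢j → cong (λ z → ⌊ z - t ⌋) (addAt-other x j N² i i≢j))
    where
    open ≡-Reasoning
    N² : ℤ
    N² = + (suc m * suc m)
    regroup : ∀ a t → a + N² - t ≡ a - t + D · D
    regroup a t = trans (cong (λ z → a + z - t) (pos-* (suc m) (suc m))) (reorder a (D · D) t)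
      where
      reorder : ∀ a c t → a + c - t ≡ a - t + c
      reorder = solve-∀

  below-next : ∀ {a t} → a ≤ t → a - (t + 1ℤ) < 0ℤ
  below-next {a} {t} a≤t =
    ≤-<-trans (subst (a - (t + 1ℤ) ≤_) (minus-next t) (+-monoˡ-≤ (- (t + 1ℤ)) a≤t)) -<+
    where
    minus-next : ∀ t → t - (t + 1ℤ) ≡ -1ℤ
    minus-next = solve-∀

  -- φₓ has a threshold: it is ≥ 0 at min x and < 0 at max x + 1.
  threshold : ∀ x → ∃ (IsThreshold (φ x))
  threshold x = threshold-exists (φ x) min≤max+1 (φ-nonneg x ≤-refl)
    (φ-negative x zero (λ i → <-trans (below-top i) (+<+ ℕ.z<s)) (below-top zero))
    where
    min≤max+1 : minCoord x ≤ maxCoord x + 1ℤ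
    min≤max+1 = ≤-trans (minCoord≤ x zero) (≤-trans (≤maxCoord x zero) (i≤i+j _ 1ℤ))
    below-top : ∀ i → x i - (maxCoord x + 1ℤ) < 0ℤ
    below-top i = below-next (≤maxCoord x i)

  M : Point (suc m) → ℤ
  M x = proj₁ (threshold x)

  M-threshold : ∀ x → IsThreshold (φ x) (M x)
  M-threshold x = proj₂ (threshold x)

  M-increasing : Increasing M
  M-increasing x y x≤y = threshold-greatest (φ-antitone y)
    (≤-trans (proj₁ (M-threshold x)) (φ-monotone (M x) x≤y)) (M-threshold y)

  M-periodic : ∀ x j → M (addAt x j (+ (suc m * suc m))) ≡ M x + D
  M-periodic x j = threshold-unique (φ-antitone x′) (M-threshold x′)
    (threshold-translate {φ = φ x} D (λ s → trans (φ-raise x j s) (sym (φ-lower x s))) (M-threshold x))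
    where
    x′ : Point (suc m)
    x′ = addAt x j (+ (suc m * suc m))

  M-at-min : ∀ x → maxCoord x - minCoord x ≤ + m → M x ≡ minCoord x
  M-at-min x spread = threshold-unique (φ-antitone x) (M-threshold x)
    (φ-nonneg x ≤-refl , φ-negative x j below-D (below-next (≤-reflexive xj≡min)))
    where
    min = minCoord x
    j = proj₁ (minCoord-attained x)
    xj≡min = proj₂ (minCoord-attained x)
    below-D : ∀ i → x i - (min + 1ℤ) < D
    below-D i = begin-strict
      x i - (min + 1ℤ) <⟨ +-monoʳ-< (x i) (neg-mono-< (i<i+1 min)) ⟩
      x i - min        ≤⟨ +-monoˡ-≤ (- min) (≤maxCoord x i) ⟩
      maxCoord x - min ≤⟨ spread ⟩
      + m              <⟨ +<+ (ℕ.n<1+n m) ⟩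
      D                ∎
      where
      open ≤-Reasoning
      i<i+1 : ∀ i → i < i + 1ℤ
      i<i+1 i = suc[i]≤j⇒i<j (≤-reflexive (+-comm 1ℤ i))

proposition6p3 : (m : ℕ) →
    Σ (Point (suc m) → ℤ) (λ M →
      Increasing M ×
      ((x : Point (suc m)) (j : Fin (suc m)) →
        M (addAt x j (+ (suc m * suc m))) ≡ M x + + suc m) ×
      ((x : Point (suc m)) →
        maxCoord x - minCoord x ≤ + m →
        M x ≡ minCoord x))
proposition6p3 m = M , M-increasing , M-periodic , M-at-min
  where open Construction m
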